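{- For every integer $n$ and every integer $k \geq 1$, \[ F(n,k) = \sum_{j \geq 0} F(n-jk,k-1,j). \]
   Context: For integers $k\ge0$: $F(n,k)=0$ for $n\le0$, $F(1,k)=1$, and $F(n,k)=\sum_{i=1}^kF(n-i,k)$ for $n\ge2$ ($k$-step Fibonacci numbers). For $r\ge0$, the $r$-th convolution is defined by: $F(n+1,k,r)$ is the coefficient of $x^n$ in $\left(\sum_{i\ge0}F(i+1,k)x^i\right)^{r+1}$ for $n\ge0$, and $F(n,k,r)=0$ for $n\le 0$. -}

module Defs where

open import Data.Nat using (ℕ; zero; suc; _+_; _*_; _∸_)
open import Data.Integer using (ℤ; +_; -[1+_])
open import Data.List using (map; upTo)
open import Data.Nat.ListAction using (sum)

-- k-step Fibonacci numbers on non-negative indices: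
--   Fℕ k n = F(n,k) for n : ℕ, with F(0,k) = 0, F(1,k) = 1,
--   F(n,k) = Σ_{i=1}^{k} F(n-i,k) for n ≥ 2.
-- SumPrev k j n = Σ_{i=1}^{j} F(n-i,k)  (terms with n-i ≤ 0 are 0).
mutual
  Fℕ : ℕ → ℕ → ℕ
  Fℕ k zero = 0
  Fℕ k (suc zero) = 1
  Fℕ k (suc (suc m)) = SumPrev k k (suc (suc m))

  SumPrev : ℕ → ℕ → ℕ → ℕ
  SumPrev k zero n = 0
  SumPrev k (suc j) zero = 0
  SumPrev k (suc j) (suc m) = Fℕ k m + SumPrev k j m

F : ℤ → ℕ → ℕ
F (+ n) k = Fℕ k n
F -[1+ n ] k = 0

cauchy : (ℕ → ℕ) → (ℕ → ℕ) → ℕ → ℕ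
cauchy a b m = sum (map (λ i → a i * b (m ∸ i)) (upTo (suc m)))

-- powSeries a r = coefficients of a^(r+1)
powSeries : (ℕ → ℕ) → ℕ → ℕ → ℕ
powSeries a zero = a
powSeries a (suc r) = cauchy a (powSeries a r)

genSeries : ℕ → ℕ → ℕ
genSeries k i = Fℕ k (suc i)

-- r-th convolution F(n,k,r): F(m+1,k,r) = [x^m] (genSeries k)^(r+1), 0 for n ≤ 0.
Fconv : ℤ → ℕ → ℕ → ℕ
Fconv (+ zero) k r = 0
Fconv (+ suc m) k r = powSeries (genSeries k) r m
Fconv -[1+ n ] k r = 0

-- As series, F(·,k) = x/(1 - x - ⋯ - x^k) and F(·,k,r) = F(·,k)^(r+1)/x^r, so
-- Σ_j x^(jk) F(·,k-1,j) is a geometric series summing to x/(1 - x - ⋯ - x^k).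
-- Coefficientwise: F(·,k-1,0) obeys the (k-1)-step recurrence and F(·,k-1,j+1) obeys it
-- with inhomogeneous term F(·,k-1,j). Hence T_N(n) = Σ_{j<N} F(n-jk,k-1,j) obeys the
-- k-step recurrence with last term T_(N-1)(n-k), and strong induction on n gives
-- T_N(n) = F(n,k) once N ≥ n.
module Submission where

open import Defs
open import Data.Nat using (ℕ; zero; suc; _+_; _*_; _∸_; _≤_; _<_; s≤s)
open import Data.Nat.Properties
  using (+-comm; +-assoc; +-identityʳ; *-distribʳ-+; +-commutativeSemigroup;
         0∸n≡0; ∸-+-assoc; m∸n≤m; ≤-trans; m≤n⇒m≤1+n)
open import Data.Nat.Induction using (<-rec)
open import Data.Nat.ListAction using (sum)
open import Data.Nat.ListAction.Properties using (sum-++)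
open import Data.Integer using (ℤ; +_; -[1+_]; _-_; _⊖_; ∣_∣)
open import Data.Integer.Properties using (m-n≡m⊖n; [1+m]⊖[1+n]≡m⊖n)
open import Data.List using (map; upTo; applyUpTo; _∷ʳ_)
open import Data.List.Properties using (map-cong; map-upTo; applyUpTo-∷ʳ)
open import Algebra.Properties.CommutativeSemigroup +-commutativeSemigroup using (interchange)
open import Relation.Binary.PropositionalEquality
  using (_≡_; refl; sym; trans; cong; cong₂; module ≡-Reasoning)
open ≡-Reasoning

∑< : ℕ → (ℕ → ℕ) → ℕ
∑< n f = sum (applyUpTo f n)

syntax ∑< n (λ i → e) = ∑[ i < n ] e

sum-map-upTo : ∀ (f : ℕ → ℕ) n → sum (map f (upTo n)) ≡ ∑< n f
sum-map-upTo f n = cong sum (map-upTo f n)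

∑-cong : ∀ {f g : ℕ → ℕ} n → (∀ i → f i ≡ g i) → ∑< n f ≡ ∑< n g
∑-cong zero    f≗g = refl
∑-cong (suc n) f≗g = cong₂ _+_ (f≗g 0) (∑-cong n (λ i → f≗g (suc i)))

∑-zero : ∀ {f : ℕ → ℕ} n → (∀ i → f i ≡ 0) → ∑< n f ≡ 0
∑-zero zero    f≗0 = refl
∑-zero (suc n) f≗0 = cong₂ _+_ (f≗0 0) (∑-zero n (λ i → f≗0 (suc i)))

∑-distrib-+ : ∀ (f g : ℕ → ℕ) n → ∑[ i < n ] (f i + g i) ≡ ∑< n f + ∑< n g
∑-distrib-+ f g zero    = refl
∑-distrib-+ f g (suc n) = begin
  f 0 + g 0 + ∑[ i < n ] (f (suc i) + g (suc i))
    ≡⟨ cong (_+_ (f 0 + g 0)) (∑-distrib-+ (λ i → f (suc i)) (λ i → g (suc i)) n) ⟩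
  f 0 + g 0 + (∑[ i < n ] f (suc i) + ∑[ i < n ] g (suc i))
    ≡⟨ interchange (f 0) (g 0) _ _ ⟩
  ∑< (suc n) f + ∑< (suc n) g ∎

∑-comm : ∀ (f : ℕ → ℕ → ℕ) m n → ∑[ i < m ] ∑[ j < n ] f i j ≡ ∑[ j < n ] ∑[ i < m ] f i j
∑-comm f zero    n = sym (∑-zero n (λ _ → refl))
∑-comm f (suc m) n = begin
  ∑[ j < n ] f 0 j + ∑[ i < m ] ∑[ j < n ] f (suc i) j
    ≡⟨ cong (_+_ (∑[ j < n ] f 0 j)) (∑-comm (λ i → f (suc i)) m n) ⟩
  ∑[ j < n ] f 0 j + ∑[ j < n ] ∑[ i < m ] f (suc i) j
    ≡⟨ sym (∑-distrib-+ (f 0) (λ j → ∑[ i < m ] f (suc i) j) n) ⟩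
  ∑[ j < n ] ∑[ i < suc m ] f i j ∎

∑-*ʳ : ∀ (f : ℕ → ℕ) n c → ∑< n f * c ≡ ∑[ i < n ] (f i * c)
∑-*ʳ f zero    c = refl
∑-*ʳ f (suc n) c =
  trans (*-distribʳ-+ c (f 0) _) (cong (_+_ (f 0 * c)) (∑-*ʳ (λ i → f (suc i)) n c))

∑-last : ∀ (f : ℕ → ℕ) n → ∑< (suc n) f ≡ ∑< n f + f n
∑-last f n = begin
  sum (applyUpTo f (suc n))  ≡⟨ cong sum (applyUpTo-∷ʳ f n) ⟨
  sum (applyUpTo f n ∷ʳ f n) ≡⟨ sum-++ (applyUpTo f n) _ ⟩
  ∑< n f + (f n + 0)         ≡⟨ cong (_+_ (∑< n f)) (+-identityʳ (f n)) ⟩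
  ∑< n f + f n               ∎

δ₁ : ℕ → ℕ
δ₁ (suc zero) = 1
δ₁ _          = 0

-- Σ_{i=1}^{j} u(n-i), with n - i truncated at 0: the terms with i ≥ n contribute u 0,
-- so this is the intended sum only for sequences with u 0 ≡ 0 (all those used here).
prevSum : (ℕ → ℕ) → ℕ → ℕ → ℕ
prevSum u j n = ∑[ i < j ] u (n ∸ suc i)

SumPrev≡prevSum : ∀ k j n → SumPrev k j n ≡ prevSum (Fℕ k) j n
SumPrev≡prevSum k zero    n       = refl
SumPrev≡prevSum k (suc j) zero    = sym (∑-zero (suc j) (λ _ → refl))
SumPrev≡prevSum k (suc j) (suc m) = cong (_+_ (Fℕ k m)) (SumPrev≡prevSum k j m)

prevSum-cong-below : ∀ {u v : ℕ → ℕ} j m → (∀ x → x ≤ m → u x ≡ v x) →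
                     prevSum u j (suc m) ≡ prevSum v j (suc m)
prevSum-cong-below j m u≗v = ∑-cong j (λ i → u≗v (m ∸ i) (m∸n≤m m i))

prevSum-suc : ∀ (u : ℕ → ℕ) j n → prevSum u (suc j) n ≡ prevSum u j n + u (n ∸ suc j)
prevSum-suc u j n = ∑-last (λ i → u (n ∸ suc i)) j

prevSum-∑ : ∀ (q : ℕ → ℕ → ℕ) N j n →
            prevSum (λ m → ∑[ i < N ] q i m) j n ≡ ∑[ i < N ] prevSum (q i) j n
prevSum-∑ q N j n = ∑-comm (λ i′ i → q i (n ∸ suc i′)) j N

prevSum-delay : ∀ (u : ℕ → ℕ) c j n → prevSum (λ m → u (m ∸ c)) j n ≡ prevSum u j (n ∸ c)
prevSum-delay u c j n = ∑-cong j (λ i → cong u (begin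
  n ∸ suc i ∸ c   ≡⟨ ∸-+-assoc n (suc i) c ⟩
  n ∸ (suc i + c) ≡⟨ cong (n ∸_) (+-comm (suc i) c) ⟩
  n ∸ (c + suc i) ≡⟨ ∸-+-assoc n c (suc i) ⟨
  n ∸ c ∸ suc i   ∎))

Fℕ-rec : ∀ k n → Fℕ k n ≡ δ₁ n + prevSum (Fℕ k) k n
Fℕ-rec k zero          = sym (∑-zero k (λ _ → refl))
Fℕ-rec k (suc zero)    = cong suc (sym (∑-zero k (λ i → cong (Fℕ k) (0∸n≡0 i))))
Fℕ-rec k (suc (suc m)) = SumPrev≡prevSum k k (suc (suc m))

Fℕ-rec-split : ∀ K n → Fℕ (suc K) n ≡ δ₁ n + prevSum (Fℕ (suc K)) K n + Fℕ (suc K) (n ∸ suc K)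
Fℕ-rec-split K n = begin
  Fℕ (suc K) n
    ≡⟨ Fℕ-rec (suc K) n ⟩
  δ₁ n + prevSum (Fℕ (suc K)) (suc K) n
    ≡⟨ cong (_+_ (δ₁ n)) (prevSum-suc (Fℕ (suc K)) K n) ⟩
  δ₁ n + (prevSum (Fℕ (suc K)) K n + Fℕ (suc K) (n ∸ suc K))
    ≡⟨ +-assoc (δ₁ n) _ _ ⟨
  δ₁ n + prevSum (Fℕ (suc K)) K n + Fℕ (suc K) (n ∸ suc K) ∎

cauchy-∑ : ∀ (a b : ℕ → ℕ) n → cauchy a b n ≡ ∑[ t < suc n ] (a t * b (n ∸ t))
cauchy-∑ a b n = sum-map-upTo (λ t → a t * b (n ∸ t)) (suc n)

shift : (ℕ → ℕ) → ℕ → ℕ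
shift a zero    = 0
shift a (suc n) = a n

shift-cauchy : ∀ (a b : ℕ → ℕ) n → shift (cauchy a b) n ≡ cauchy (shift a) b n
shift-cauchy a b zero    = refl
shift-cauchy a b (suc m) = trans (cauchy-∑ a b m) (sym (cauchy-∑ (shift a) b (suc m)))

cauchy-congˡ : ∀ {u v : ℕ → ℕ} b → (∀ t → u t ≡ v t) → ∀ n → cauchy u b n ≡ cauchy v b n
cauchy-congˡ b u≗v n =
  cong sum (map-cong (λ t → cong (λ x → x * b (n ∸ t)) (u≗v t)) (upTo (suc n)))

cauchy-+ˡ : ∀ (u v b : ℕ → ℕ) n → cauchy (λ t → u t + v t) b n ≡ cauchy u b n + cauchy v b n
cauchy-+ˡ u v b n = begin
  cauchy (λ t → u t + v t) b n
    ≡⟨ cauchy-∑ (λ t → u t + v t) b n ⟩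
  ∑[ t < suc n ] ((u t + v t) * b (n ∸ t))
    ≡⟨ ∑-cong (suc n) (λ t → *-distribʳ-+ (b (n ∸ t)) (u t) (v t)) ⟩
  ∑[ t < suc n ] (u t * b (n ∸ t) + v t * b (n ∸ t))
    ≡⟨ ∑-distrib-+ (λ t → u t * b (n ∸ t)) (λ t → v t * b (n ∸ t)) (suc n) ⟩
  ∑[ t < suc n ] (u t * b (n ∸ t)) + ∑[ t < suc n ] (v t * b (n ∸ t))
    ≡⟨ cong₂ _+_ (cauchy-∑ u b n) (cauchy-∑ v b n) ⟨
  cauchy u b n + cauchy v b n ∎

cauchy-∑ˡ : ∀ (q : ℕ → ℕ → ℕ) b J n →
            cauchy (λ t → ∑[ i < J ] q i t) b n ≡ ∑[ i < J ] cauchy (q i) b n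
cauchy-∑ˡ q b J n = begin
  cauchy (λ t → ∑[ i < J ] q i t) b n
    ≡⟨ cauchy-∑ (λ t → ∑[ i < J ] q i t) b n ⟩
  ∑[ t < suc n ] ((∑[ i < J ] q i t) * b (n ∸ t))
    ≡⟨ ∑-cong (suc n) (λ t → ∑-*ʳ (λ i → q i t) J (b (n ∸ t))) ⟩
  ∑[ t < suc n ] ∑[ i < J ] (q i t * b (n ∸ t))
    ≡⟨ ∑-comm (λ t i → q i t * b (n ∸ t)) (suc n) J ⟩
  ∑[ i < J ] ∑[ t < suc n ] (q i t * b (n ∸ t))
    ≡⟨ ∑-cong J (λ i → cauchy-∑ (q i) b n) ⟨
  ∑[ i < J ] cauchy (q i) b n ∎

cauchy-delay₁ : ∀ (u b : ℕ → ℕ) → u 0 ≡ 0 → ∀ n →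
                cauchy (λ t → u (t ∸ 1)) b n ≡ cauchy u b (n ∸ 1)
cauchy-delay₁ u b u0≡0 zero    = refl
cauchy-delay₁ u b u0≡0 (suc m) = begin
  cauchy (λ t → u (t ∸ 1)) b (suc m)
    ≡⟨ cauchy-∑ (λ t → u (t ∸ 1)) b (suc m) ⟩
  u 0 * b (suc m) + ∑[ t < suc m ] (u t * b (m ∸ t))
    ≡⟨ cong (λ x → x * b (suc m) + ∑[ t < suc m ] (u t * b (m ∸ t))) u0≡0 ⟩
  ∑[ t < suc m ] (u t * b (m ∸ t))
    ≡⟨ cauchy-∑ u b m ⟨
  cauchy u b m ∎

cauchy-delay : ∀ (u b : ℕ → ℕ) → u 0 ≡ 0 → ∀ c n →
               cauchy (λ t → u (t ∸ c)) b n ≡ cauchy u b (n ∸ c)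
cauchy-delay u b u0≡0 zero    n = refl
cauchy-delay u b u0≡0 (suc c) n = begin
  cauchy (λ t → u (t ∸ suc c)) b n
    ≡⟨ cauchy-congˡ b (λ t → cong u (∸-+-assoc t 1 c)) n ⟨
  cauchy (λ t → u (t ∸ 1 ∸ c)) b n
    ≡⟨ cauchy-delay₁ (λ s → u (s ∸ c)) b (trans (cong u (0∸n≡0 c)) u0≡0) n ⟩
  cauchy (λ s → u (s ∸ c)) b (n ∸ 1)
    ≡⟨ cauchy-delay u b u0≡0 c (n ∸ 1) ⟩
  cauchy u b (n ∸ 1 ∸ c)
    ≡⟨ cong (cauchy u b) (∸-+-assoc n 1 c) ⟩
  cauchy u b (n ∸ suc c) ∎

cauchy-prevSumˡ : ∀ (u b : ℕ → ℕ) → u 0 ≡ 0 → ∀ j n →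
                  cauchy (prevSum u j) b n ≡ prevSum (cauchy u b) j n
cauchy-prevSumˡ u b u0≡0 j n =
  trans (cauchy-∑ˡ (λ i t → u (t ∸ suc i)) b j n)
        (∑-cong j (λ i → cauchy-delay u b u0≡0 (suc i) n))

cauchy-δ₁ : ∀ (b : ℕ → ℕ) n → cauchy δ₁ b n ≡ shift b n
cauchy-δ₁ b zero    = refl
cauchy-δ₁ b (suc m) = begin
  cauchy δ₁ b (suc m)           ≡⟨ cauchy-∑ δ₁ b (suc m) ⟩
  b m + 0 + ∑[ t < m ] 0        ≡⟨ cong₂ _+_ (+-identityʳ (b m)) (∑-zero m (λ _ → refl)) ⟩
  b m + 0                       ≡⟨ +-identityʳ (b m) ⟩
  b m                           ∎

Fconvℕ : ℕ → ℕ → ℕ → ℕ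
Fconvℕ k r = shift (powSeries (genSeries k) r)

Fconv-+ : ∀ n k r → Fconv (+ n) k r ≡ Fconvℕ k r n
Fconv-+ zero    k r = refl
Fconv-+ (suc n) k r = refl

Fconv-⊖ : ∀ n m k r → Fconv (n ⊖ m) k r ≡ Fconvℕ k r (n ∸ m)
Fconv-⊖ n       zero    k r = Fconv-+ n k r
Fconv-⊖ zero    (suc m) k r = refl
Fconv-⊖ (suc n) (suc m) k r =
  trans (cong (λ z → Fconv z k r) ([1+m]⊖[1+n]≡m⊖n n m)) (Fconv-⊖ n m k r)

Fconv-minus : ∀ n m k r → Fconv (+ n - + m) k r ≡ Fconvℕ k r (n ∸ m)
Fconv-minus n m k r = trans (cong (λ z → Fconv z k r) (m-n≡m⊖n n m)) (Fconv-⊖ n m k r)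

Fconv-negative-minus : ∀ n m k r → Fconv (-[1+ n ] - + m) k r ≡ 0
Fconv-negative-minus n zero    k r = refl
Fconv-negative-minus n (suc m) k r = refl

Fconvℕ-zero : ∀ k n → Fconvℕ k 0 n ≡ Fℕ k n
Fconvℕ-zero k zero    = refl
Fconvℕ-zero k (suc n) = refl

Fconvℕ-suc : ∀ k r n → Fconvℕ k (suc r) n ≡ cauchy (Fℕ k) (powSeries (genSeries k) r) n
Fconvℕ-suc k r n = trans (shift-cauchy (genSeries k) (powSeries (genSeries k) r) n)
                         (cauchy-congˡ (powSeries (genSeries k) r) (Fconvℕ-zero k) n)

Fconvℕ-rec-zero : ∀ k n → Fconvℕ k 0 n ≡ δ₁ n + prevSum (Fconvℕ k 0) k n
Fconvℕ-rec-zero k n = begin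
  Fconvℕ k 0 n
    ≡⟨ Fconvℕ-zero k n ⟩
  Fℕ k n
    ≡⟨ Fℕ-rec k n ⟩
  δ₁ n + prevSum (Fℕ k) k n
    ≡⟨ cong (_+_ (δ₁ n)) (∑-cong k (λ i → Fconvℕ-zero k (n ∸ suc i))) ⟨
  δ₁ n + prevSum (Fconvℕ k 0) k n ∎

Fconvℕ-rec-suc : ∀ k r n → Fconvℕ k (suc r) n ≡ Fconvℕ k r n + prevSum (Fconvℕ k (suc r)) k n
Fconvℕ-rec-suc k r n = begin
  Fconvℕ k (suc r) n
    ≡⟨ Fconvℕ-suc k r n ⟩
  cauchy (Fℕ k) P n
    ≡⟨ cauchy-congˡ P (Fℕ-rec k) n ⟩
  cauchy (λ t → δ₁ t + prevSum (Fℕ k) k t) P n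
    ≡⟨ cauchy-+ˡ δ₁ (prevSum (Fℕ k) k) P n ⟩
  cauchy δ₁ P n + cauchy (prevSum (Fℕ k) k) P n
    ≡⟨ cong₂ _+_ (cauchy-δ₁ P n) (cauchy-prevSumˡ (Fℕ k) P refl k n) ⟩
  Fconvℕ k r n + prevSum (cauchy (Fℕ k) P) k n
    ≡⟨ cong (_+_ (Fconvℕ k r n)) (∑-cong k (λ i → Fconvℕ-suc k r (n ∸ suc i))) ⟨
  Fconvℕ k r n + prevSum (Fconvℕ k (suc r)) k n ∎
  where
  P : ℕ → ℕ
  P = powSeries (genSeries k) r

module _ (K : ℕ) where

  convSum : ℕ → ℕ → ℕ
  convSum N n = ∑[ j < N ] Fconvℕ K j (n ∸ j * suc K)

  convSum-zero : ∀ N → convSum N 0 ≡ 0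
  convSum-zero N = ∑-zero N (λ j → cong (Fconvℕ K j) (0∸n≡0 (j * suc K)))

  convSum-rec : ∀ N n → convSum (suc N) n ≡
                δ₁ n + prevSum (convSum (suc N)) K n + convSum N (n ∸ suc K)
  convSum-rec N n = begin
    g 0 n + ∑[ j < N ] g (suc j) (n ∸ suc j * suc K)
      ≡⟨ cong₂ _+_ (Fconvℕ-rec-zero K n)
                   (∑-cong N (λ j → Fconvℕ-rec-suc K j (n ∸ suc j * suc K))) ⟩
    (δ₁ n + prevSum (g 0) K n) + ∑[ j < N ] (g j (n ∸ suc j * suc K) + Y j)
      ≡⟨ cong (_+_ (δ₁ n + prevSum (g 0) K n))
              (∑-distrib-+ (λ j → g j (n ∸ suc j * suc K)) Y N) ⟩
    (δ₁ n + prevSum (g 0) K n) + (∑[ j < N ] g j (n ∸ suc j * suc K) + ∑< N Y)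
      ≡⟨ rearrange (δ₁ n) (prevSum (g 0) K n) _ (∑< N Y) ⟩
    δ₁ n + (prevSum (g 0) K n + ∑< N Y) + ∑[ j < N ] g j (n ∸ suc j * suc K)
      ≡⟨ cong₂ (λ u v → δ₁ n + u + v) prevSum-convSum delayed-convSum ⟩
    δ₁ n + prevSum (convSum (suc N)) K n + convSum N (n ∸ suc K) ∎
    where
    g : ℕ → ℕ → ℕ
    g = Fconvℕ K

    Y : ℕ → ℕ
    Y j = prevSum (g (suc j)) K (n ∸ suc j * suc K)

    rearrange : ∀ a b x y → (a + b) + (x + y) ≡ a + (b + y) + x
    rearrange a b x y = begin
      (a + b) + (x + y) ≡⟨ cong (_+_ (a + b)) (+-comm x y) ⟩
      (a + b) + (y + x) ≡⟨ +-assoc (a + b) y x ⟨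
      (a + b) + y + x   ≡⟨ cong (λ z → z + x) (+-assoc a b y) ⟩
      a + (b + y) + x   ∎

    prevSum-convSum : prevSum (g 0) K n + ∑< N Y ≡ prevSum (convSum (suc N)) K n
    prevSum-convSum = begin
      ∑[ j < suc N ] prevSum (g j) K (n ∸ j * suc K)
        ≡⟨ ∑-cong (suc N) (λ j → prevSum-delay (g j) (j * suc K) K n) ⟨
      ∑[ j < suc N ] prevSum (λ m → g j (m ∸ j * suc K)) K n
        ≡⟨ prevSum-∑ (λ j m → g j (m ∸ j * suc K)) (suc N) K n ⟨
      prevSum (convSum (suc N)) K n ∎

    delayed-convSum : ∑[ j < N ] g j (n ∸ suc j * suc K) ≡ convSum N (n ∸ suc K)
    delayed-convSum = ∑-cong N (λ j → cong (g j) (sym (∸-+-assoc n (suc K) (j * suc K))))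

  convSum≡Fℕ : ∀ n N → n ≤ N → convSum N n ≡ Fℕ (suc K) n
  convSum≡Fℕ = <-rec (λ n → ∀ N → n ≤ N → convSum N n ≡ Fℕ (suc K) n) step
    where
    step : ∀ n → (∀ {x} → x < n → ∀ N → x ≤ N → convSum N x ≡ Fℕ (suc K) x) →
           ∀ N → n ≤ N → convSum N n ≡ Fℕ (suc K) n
    step zero    ih N       _         = convSum-zero N
    step (suc m) ih (suc N) (s≤s m≤N) = begin
      convSum (suc N) (suc m)
        ≡⟨ convSum-rec N (suc m) ⟩
      δ₁ (suc m) + prevSum (convSum (suc N)) K (suc m) + convSum N (m ∸ K)
        ≡⟨ cong₂ (λ u v → δ₁ (suc m) + u + v)
                 (prevSum-cong-below K m (λ x x≤m →
                    ih (s≤s x≤m) (suc N) (≤-trans x≤m (m≤n⇒m≤1+n m≤N))))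
                 (ih (s≤s (m∸n≤m m K)) N (≤-trans (m∸n≤m m K) m≤N)) ⟩
      δ₁ (suc m) + prevSum (Fℕ (suc K)) K (suc m) + Fℕ (suc K) (m ∸ K)
        ≡⟨ Fℕ-rec-split K (suc m) ⟨
      Fℕ (suc K) (suc m) ∎

mainTheorem12 : (n : ℤ) (k : ℕ) → 1 ≤ k → (N : ℕ) → ∣ n ∣ ≤ N →
    sum (map (λ j → Fconv (n - + (j * k)) (k ∸ 1) j) (upTo N)) ≡ F n k
mainTheorem12 (+ n) (suc K) _ N n≤N = begin
  sum (map (λ j → Fconv (+ n - + (j * suc K)) K j) (upTo N))
    ≡⟨ sum-map-upTo (λ j → Fconv (+ n - + (j * suc K)) K j) N ⟩
  ∑[ j < N ] Fconv (+ n - + (j * suc K)) K j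
    ≡⟨ ∑-cong N (λ j → Fconv-minus n (j * suc K) K j) ⟩
  convSum K N n
    ≡⟨ convSum≡Fℕ K n N n≤N ⟩
  Fℕ (suc K) n ∎
mainTheorem12 -[1+ n ] (suc K) _ N _ =
  trans (sum-map-upTo (λ j → Fconv (-[1+ n ] - + (j * suc K)) K j) N)
        (∑-zero N (λ j → Fconv-negative-minus n (j * suc K) K j))
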